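{- If $n$ is a non-negative integer, then \[ \sum_{k = 1}^n \sum_{j = 0}^{k - 1} \frac{2^{2j}}{k - j} \binom{2(n - j)}{n - j} = 2^{2n + 1} + \left(H_n - 2\right)(2n + 1)\binom{2n}{n} \] and \[ \sum_{k = 1}^n \sum_{j = 0}^{k - 1} \frac{2^{2j}}{2k - 2j - 1} \binom{2(n - j)}{n - j} = \left(O_{n + 1} - 1 \right)(2n + 1)\binom{2n}{n}. \]
   Context: $H_n=\sum_{m=1}^n\frac1m$ and $O_n=\sum_{m=1}^n\frac1{2m-1}$. Empty sums are $0$. -}

module Defs where

open import Data.Nat as ℕ using (ℕ; zero; suc; _∸_)
open import Data.Integer using (+_)
open import Data.Rational using (ℚ; 0ℚ; _+_; _/_)

sumRange : ℕ → (ℕ → ℚ) → ℚ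
sumRange zero    f = 0ℚ
sumRange (suc n) f = sumRange n f + f n

sum1to : ℕ → (ℕ → ℚ) → ℚ
sum1to n f = sumRange n (λ i → f (suc i))

ℕtoℚ : ℕ → ℚ
ℕtoℚ n = + n / 1

-- 1/m as a rational; only ever used at m ≥ 1 (value at 0 is an irrelevant junk value 0)
recip : ℕ → ℚ
recip zero    = 0ℚ
recip (suc m) = + 1 / suc m

H : ℕ → ℚ
H n = sum1to n recip

O : ℕ → ℚ
O n = sum1to n (λ m → recip (2 ℕ.* m ∸ 1))

{-# OPTIONS --safe #-}
-- Peeling off the j = 0 column shows that the double sum T n with weights 4^j and inner
-- denominators a (k - j) satisfies T (n + 1) = 4 T n + C(2n+2, n+1) (a 1 + ... + a (n + 1)),
-- with a i = 1/i for the first identity and a i = 1/(2i - 1) for the second.  Since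
-- (n + 1) C(2n+2, n+1) = 2 (2n + 1) C(2n, n), both right-hand sides satisfy the same
-- recurrence, and both sides vanish at n = 0.
module Submission where

module Binomial where

  open import Data.Nat
  open import Data.Nat.Properties
  open import Data.Nat.Combinatorics
  open import Relation.Binary.PropositionalEquality

  [k+1]*[n+1]C[k+1]≡[n+1]*nCk : ∀ n k → suc k * (suc n C suc k) ≡ suc n * (n C k)
  [k+1]*[n+1]C[k+1]≡[n+1]*nCk zero    zero    = refl
  [k+1]*[n+1]C[k+1]≡[n+1]*nCk zero    (suc k) = *-zeroʳ (2 + k)
  [k+1]*[n+1]C[k+1]≡[n+1]*nCk (suc n) zero    =
    trans (+-identityʳ _) (trans (nC1≡n (2 + n)) (sym (*-identityʳ (2 + n))))
  [k+1]*[n+1]C[k+1]≡[n+1]*nCk (suc n) (suc k) = begin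
    suc (suc k) * (suc (suc n) C suc (suc k))
      ≡⟨ cong (suc (suc k) *_) (nCk+nC[k+1]≡[n+1]C[k+1] (suc n) (suc k)) ⟨
    suc (suc k) * (a + b)
      ≡⟨ *-distribˡ-+ (suc (suc k)) a b ⟩
    (a + suc k * a) + suc (suc k) * b
      ≡⟨ cong₂ (λ x y → (a + x) + y)
               ([k+1]*[n+1]C[k+1]≡[n+1]*nCk n k) ([k+1]*[n+1]C[k+1]≡[n+1]*nCk n (suc k)) ⟩
    (a + suc n * (n C k)) + suc n * (n C suc k)
      ≡⟨ +-assoc a _ _ ⟩
    a + (suc n * (n C k) + suc n * (n C suc k))
      ≡⟨ cong (a +_) (*-distribˡ-+ (suc n) (n C k) (n C suc k)) ⟨
    a + suc n * (n C k + n C suc k)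
      ≡⟨ cong (λ x → a + suc n * x) (nCk+nC[k+1]≡[n+1]C[k+1] n k) ⟩
    suc (suc n) * a ∎
    where
    open ≡-Reasoning
    a b : ℕ
    a = suc n C suc k
    b = suc n C suc (suc k)

  [m+n]Cm≡[m+n]Cn : ∀ m n → (m + n) C m ≡ (m + n) C n
  [m+n]Cm≡[m+n]Cn m n = trans (nCk≡nC[n∸k] (m≤m+n m n)) (cong ((m + n) C_) (m+n∸m≡n m n))

  [n+1]*[2n+2]C[n+1]≡2*[2n+1]*[2n]Cn : ∀ n →
    suc n * ((2 * suc n) C suc n) ≡ 2 * (suc (2 * n) * ((2 * n) C n))
  [n+1]*[2n+2]C[n+1]≡2*[2n+1]*[2n]Cn n = begin
    suc n * ((2 * suc n) C suc n)
      ≡⟨ cong (λ m → suc n * (m C suc n)) (*-suc 2 n) ⟩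
    suc n * ((2 + 2 * n) C suc n)
      ≡⟨ [k+1]*[n+1]C[k+1]≡[n+1]*nCk (suc (2 * n)) n ⟩
    (2 + 2 * n) * (suc (2 * n) C n)
      ≡⟨ cong₂ (λ a b → a * (b C n)) (sym (*-suc 2 n)) 2n+1≡n+[n+1] ⟩
    2 * suc n * ((n + suc n) C n)
      ≡⟨ cong (2 * suc n *_) (trans ([m+n]Cm≡[m+n]Cn n (suc n)) (cong (_C suc n) (sym 2n+1≡n+[n+1]))) ⟩
    2 * suc n * (suc (2 * n) C suc n)
      ≡⟨ *-assoc 2 (suc n) _ ⟩
    2 * (suc n * (suc (2 * n) C suc n))
      ≡⟨ cong (2 *_) ([k+1]*[n+1]C[k+1]≡[n+1]*nCk (2 * n) n) ⟩
    2 * (suc (2 * n) * ((2 * n) C n)) ∎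
    where
    open ≡-Reasoning
    2n+1≡n+[n+1] : suc (2 * n) ≡ n + suc n
    2n+1≡n+[n+1] = trans (cong (λ m → suc (n + m)) (+-identityʳ n)) (sym (+-suc n n))

open import Defs
open import Data.List using (_∷_; [])
open import Data.Nat as ℕ using (ℕ; zero; suc; _∸_; _^_)
import Data.Nat.Properties as ℕ
open import Data.Nat.Combinatorics using (_C_)
open import Data.Nat.Coprimality using (1-coprimeTo)
import Data.Nat.Coprimality as Coprime
open import Data.Integer using (+_)
import Data.Integer as ℤ
import Data.Integer.Properties as ℤ
open import Data.Rational using (ℚ; mkℚ; 0ℚ; 1ℚ; _+_; _-_; _*_; _/_; 1/_)
open import Data.Rational.Properties
  using (_≟_; +-*-commutativeRing; +-0-commutativeMonoid; normalize-coprime; /-cong;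
         +-assoc; +-comm; +-identityˡ; +-identityʳ; *-assoc; *-comm; *-identityˡ; *-zeroʳ; *-zeroˡ;
         *-distribˡ-+; *-distribʳ-+; *-inverseˡ)
open import Algebra.Bundles using (CommutativeMonoid)
open import Algebra.Properties.CommutativeSemigroup
  (CommutativeMonoid.commutativeSemigroup +-0-commutativeMonoid) using (interchange)
open import Data.Product using (_×_; _,_)
open import Relation.Binary.PropositionalEquality
open import Relation.Nullary.Decidable using (dec⇒maybe)
open import Tactic.RingSolver using (solve)
open import Tactic.RingSolver.Core.AlmostCommutativeRing using (AlmostCommutativeRing; fromCommutativeRing)
open ≡-Reasoning

open Binomial using ([n+1]*[2n+2]C[n+1]≡2*[2n+1]*[2n]Cn)

ℚ-ring : AlmostCommutativeRing _ _
ℚ-ring = fromCommutativeRing +-*-commutativeRing (λ x → dec⇒maybe (0ℚ ≟ x))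

ℕtoℚ≡mkℚ : ∀ n → ℕtoℚ n ≡ mkℚ (+ n) 0 (Coprime.sym (1-coprimeTo n))
ℕtoℚ≡mkℚ n = normalize-coprime (Coprime.sym (1-coprimeTo n))

ℕtoℚ-homo-+ : ∀ m n → ℕtoℚ (m ℕ.+ n) ≡ ℕtoℚ m + ℕtoℚ n
ℕtoℚ-homo-+ m n = begin
  + (m ℕ.+ n) / 1
    ≡⟨ /-cong (trans (ℤ.pos-+ m n) (sym (cong₂ ℤ._+_ (ℤ.*-identityʳ (+ m)) (ℤ.*-identityʳ (+ n))))) refl ⟩
  (+ m ℤ.* + 1 ℤ.+ + n ℤ.* + 1) / 1
    ≡⟨ cong₂ _+_ (ℕtoℚ≡mkℚ m) (ℕtoℚ≡mkℚ n) ⟨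
  ℕtoℚ m + ℕtoℚ n ∎

ℕtoℚ-homo-* : ∀ m n → ℕtoℚ (m ℕ.* n) ≡ ℕtoℚ m * ℕtoℚ n
ℕtoℚ-homo-* m n = begin
  + (m ℕ.* n) / 1          ≡⟨ /-cong (ℤ.pos-* m n) refl ⟩
  (+ m ℤ.* + n) / 1        ≡⟨ cong₂ _*_ (ℕtoℚ≡mkℚ m) (ℕtoℚ≡mkℚ n) ⟨
  ℕtoℚ m * ℕtoℚ n          ∎

recip-inverseˡ : ∀ m → recip (suc m) * ℕtoℚ (suc m) ≡ 1ℚ
-- recip (suc m) = + 1 / suc m normalises to mkℚ (+ 1) m _, which is 1/ q by definition.
recip-inverseˡ m = begin
  recip (suc m) * ℕtoℚ (suc m)
    ≡⟨ cong₂ _*_ (normalize-coprime (1-coprimeTo (suc m))) (ℕtoℚ≡mkℚ (suc m)) ⟩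
  1/ q * q
    ≡⟨ *-inverseˡ q ⟩
  1ℚ ∎
  where
  q : ℚ
  q = mkℚ (+ suc m) 0 (Coprime.sym (1-coprimeTo (suc m)))

sumRange-cong : ∀ n {f g : ℕ → ℚ} → (∀ i → f i ≡ g i) → sumRange n f ≡ sumRange n g
sumRange-cong zero    f≗g = refl
sumRange-cong (suc n) f≗g = cong₂ _+_ (sumRange-cong n f≗g) (f≗g n)

sumRange-+ : ∀ n (f g : ℕ → ℚ) → sumRange n (λ i → f i + g i) ≡ sumRange n f + sumRange n g
sumRange-+ zero    f g = refl
sumRange-+ (suc n) f g =
  trans (cong (_+ (f n + g n)) (sumRange-+ n f g)) (interchange (sumRange n f) (sumRange n g) (f n) (g n))

sumRange-*ˡ : ∀ n q (f : ℕ → ℚ) → sumRange n (λ i → q * f i) ≡ q * sumRange n f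
sumRange-*ˡ zero    q f = sym (*-zeroʳ q)
sumRange-*ˡ (suc n) q f = trans (cong (_+ q * f n) (sumRange-*ˡ n q f)) (sym (*-distribˡ-+ q (sumRange n f) (f n)))

sumRange-*ʳ : ∀ n q (f : ℕ → ℚ) → sumRange n (λ i → f i * q) ≡ sumRange n f * q
sumRange-*ʳ zero    q f = sym (*-zeroˡ q)
sumRange-*ʳ (suc n) q f = trans (cong (_+ f n * q) (sumRange-*ʳ n q f)) (sym (*-distribʳ-+ q (sumRange n f) (f n)))

sumRange-suc : ∀ n (f : ℕ → ℚ) → sumRange (suc n) f ≡ f 0 + sumRange n (λ i → f (suc i))
sumRange-suc zero    f = trans (+-identityˡ (f 0)) (sym (+-identityʳ (f 0)))
sumRange-suc (suc n) f = trans (cong (_+ f (suc n)) (sumRange-suc n f)) (+-assoc (f 0) _ _)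

triangleSum : (w a c : ℕ → ℚ) → ℕ → ℚ
triangleSum w a c n = sum1to n (λ k → sumRange k (λ j → w j * a (k ∸ j) * c (n ∸ j)))

triangleSum-suc : ∀ {q} {w a c : ℕ → ℚ} → w 0 ≡ 1ℚ → (∀ j → w (suc j) ≡ q * w j) →
  ∀ n → triangleSum w a c (suc n) ≡ q * triangleSum w a c n + c (suc n) * sum1to (suc n) a
triangleSum-suc {q} {w} {a} {c} w0≡1 w-suc n = begin
  triangleSum w a c (suc n)
    ≡⟨ sumRange-cong (suc n) (λ k → sumRange-suc k _) ⟩
  sumRange (suc n) (λ k → w 0 * a (suc k) * c (suc n) + shifted k)
    ≡⟨ sumRange-+ (suc n) _ shifted ⟩
  sumRange (suc n) (λ k → w 0 * a (suc k) * c (suc n)) + sumRange (suc n) shifted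
    ≡⟨ cong₂ _+_ first-column other-columns ⟩
  c (suc n) * sum1to (suc n) a + q * triangleSum w a c n
    ≡⟨ +-comm (c (suc n) * sum1to (suc n) a) _ ⟩
  q * triangleSum w a c n + c (suc n) * sum1to (suc n) a ∎
  where
  shifted : ℕ → ℚ
  shifted k = sumRange k (λ j → w (suc j) * a (k ∸ j) * c (n ∸ j))

  first-column : sumRange (suc n) (λ k → w 0 * a (suc k) * c (suc n)) ≡ c (suc n) * sum1to (suc n) a
  first-column = begin
    sumRange (suc n) (λ k → w 0 * a (suc k) * c (suc n))
      ≡⟨ sumRange-cong (suc n) (λ k → cong (_* c (suc n))
           (trans (cong (_* a (suc k)) w0≡1) (*-identityˡ (a (suc k))))) ⟩
    sumRange (suc n) (λ k → a (suc k) * c (suc n))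
      ≡⟨ sumRange-*ʳ (suc n) (c (suc n)) (λ k → a (suc k)) ⟩
    sum1to (suc n) a * c (suc n)
      ≡⟨ *-comm (sum1to (suc n) a) (c (suc n)) ⟩
    c (suc n) * sum1to (suc n) a ∎

  factor-q : ∀ k j → w (suc j) * a (k ∸ j) * c (n ∸ j) ≡ q * (w j * a (k ∸ j) * c (n ∸ j))
  factor-q k j = begin
    w (suc j) * a (k ∸ j) * c (n ∸ j)    ≡⟨ cong (λ x → x * a (k ∸ j) * c (n ∸ j)) (w-suc j) ⟩
    q * w j * a (k ∸ j) * c (n ∸ j)      ≡⟨ cong (_* c (n ∸ j)) (*-assoc q (w j) (a (k ∸ j))) ⟩
    q * (w j * a (k ∸ j)) * c (n ∸ j)    ≡⟨ *-assoc q _ (c (n ∸ j)) ⟩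
    q * (w j * a (k ∸ j) * c (n ∸ j))    ∎

  other-columns : sumRange (suc n) shifted ≡ q * triangleSum w a c n
  other-columns = begin
    sumRange (suc n) shifted
      ≡⟨ sumRange-suc n shifted ⟩
    0ℚ + sumRange n (λ k → shifted (suc k))
      ≡⟨ +-identityˡ _ ⟩
    sumRange n (λ k → shifted (suc k))
      ≡⟨ sumRange-cong n (λ k → trans (sumRange-cong (suc k) (factor-q (suc k))) (sumRange-*ˡ (suc k) q _)) ⟩
    sumRange n (λ k → q * sumRange (suc k) (λ j → w j * a (suc k ∸ j) * c (n ∸ j)))
      ≡⟨ sumRange-*ˡ n q _ ⟩
    q * triangleSum w a c n ∎

recurrence-unique : ∀ {A : Set} (step : ℕ → A → A) {f g : ℕ → A} → f 0 ≡ g 0 →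
  (∀ n → f (suc n) ≡ step n (f n)) → (∀ n → g (suc n) ≡ step n (g n)) → ∀ n → f n ≡ g n
recurrence-unique step f0≡g0 f-suc g-suc zero    = f0≡g0
recurrence-unique step f0≡g0 f-suc g-suc (suc n) =
  trans (f-suc n) (trans (cong (step n) (recurrence-unique step f0≡g0 f-suc g-suc n)) (sym (g-suc n)))

fourPow : ℕ → ℚ
fourPow j = ℕtoℚ (2 ^ (2 ℕ.* j))

centralBinomial : ℕ → ℚ
centralBinomial m = ℕtoℚ ((2 ℕ.* m) C m)

oddRecip : ℕ → ℚ
oddRecip i = recip (2 ℕ.* i ∸ 1)

ℕtoℚ-2^[2+m] : ∀ m → ℕtoℚ (2 ^ (2 ℕ.+ m)) ≡ ℕtoℚ 4 * ℕtoℚ (2 ^ m)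
ℕtoℚ-2^[2+m] m = trans (cong ℕtoℚ (sym (ℕ.*-assoc 2 2 (2 ^ m)))) (ℕtoℚ-homo-* 4 (2 ^ m))

fourPow-suc : ∀ j → fourPow (suc j) ≡ ℕtoℚ 4 * fourPow j
fourPow-suc j = trans (cong (λ e → ℕtoℚ (2 ^ e)) (ℕ.*-suc 2 j)) (ℕtoℚ-2^[2+m] (2 ℕ.* j))

ℕtoℚ-2m+1 : ∀ m → ℕtoℚ (2 ℕ.* m ℕ.+ 1) ≡ ℕtoℚ 2 * ℕtoℚ m + 1ℚ
ℕtoℚ-2m+1 m = trans (ℕtoℚ-homo-+ (2 ℕ.* m) 1) (cong (_+ 1ℚ) (ℕtoℚ-homo-* 2 m))

oddRecip-inverseˡ : ∀ m → oddRecip (suc m) * ℕtoℚ (2 ℕ.* m ℕ.+ 1) ≡ 1ℚ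
oddRecip-inverseˡ m = begin
  recip (2 ℕ.* suc m ∸ 1) * ℕtoℚ (2 ℕ.* m ℕ.+ 1)
    ≡⟨ cong₂ (λ a b → recip (a ∸ 1) * ℕtoℚ b) (ℕ.*-suc 2 m) (ℕ.+-comm (2 ℕ.* m) 1) ⟩
  recip (suc (2 ℕ.* m)) * ℕtoℚ (suc (2 ℕ.* m))
    ≡⟨ recip-inverseˡ (2 ℕ.* m) ⟩
  1ℚ ∎

centralBinomial-suc : ∀ n →
  ℕtoℚ (suc n) * centralBinomial (suc n) ≡ ℕtoℚ 2 * (ℕtoℚ (2 ℕ.* n ℕ.+ 1) * centralBinomial n)
centralBinomial-suc n = begin
  ℕtoℚ (suc n) * centralBinomial (suc n)
    ≡⟨ ℕtoℚ-homo-* (suc n) ((2 ℕ.* suc n) C suc n) ⟨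
  ℕtoℚ (suc n ℕ.* ((2 ℕ.* suc n) C suc n))
    ≡⟨ cong ℕtoℚ ([n+1]*[2n+2]C[n+1]≡2*[2n+1]*[2n]Cn n) ⟩
  ℕtoℚ (2 ℕ.* (suc (2 ℕ.* n) ℕ.* ((2 ℕ.* n) C n)))
    ≡⟨ ℕtoℚ-homo-* 2 (suc (2 ℕ.* n) ℕ.* ((2 ℕ.* n) C n)) ⟩
  ℕtoℚ 2 * ℕtoℚ (suc (2 ℕ.* n) ℕ.* ((2 ℕ.* n) C n))
    ≡⟨ cong (ℕtoℚ 2 *_) (ℕtoℚ-homo-* (suc (2 ℕ.* n)) ((2 ℕ.* n) C n)) ⟩
  ℕtoℚ 2 * (ℕtoℚ (suc (2 ℕ.* n)) * centralBinomial n)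
    ≡⟨ cong (λ m → ℕtoℚ 2 * (ℕtoℚ m * centralBinomial n)) (ℕ.+-comm 1 (2 ℕ.* n)) ⟩
  ℕtoℚ 2 * (ℕtoℚ (2 ℕ.* n ℕ.+ 1) * centralBinomial n) ∎

-- With s = n + 1, m = 2n + 1, x = C(2n, n), y = C(2n+2, n+1) and r the new harmonic term, each
-- identity is linear in the relations s y = 2 m x and r s = 1 (resp. r (2s + 1) = 1), so after
-- substituting them it is a ring identity.
harmonic-recurrence-identity : ∀ P h r s m x y → r * s ≡ 1ℚ → s * y ≡ ℕtoℚ 2 * (m * x) →
  ℕtoℚ 4 * (P + (h - ℕtoℚ 2) * m * x) + y * (h + r)
    ≡ ℕtoℚ 4 * P + (h + r - ℕtoℚ 2) * (ℕtoℚ 2 * s + 1ℚ) * y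
harmonic-recurrence-identity P h r s m x y rs≡1 sy≡2mx = begin
  ℕtoℚ 4 * (P + (h - ℕtoℚ 2) * m * x) + y * (h + r)
    ≡⟨ solve (P ∷ h ∷ r ∷ m ∷ x ∷ y ∷ []) ℚ-ring ⟩
  ℕtoℚ 4 * P + ℕtoℚ 2 * (h - ℕtoℚ 2) * (ℕtoℚ 2 * (m * x)) + ℕtoℚ 2 * y * 1ℚ + (h + r - ℕtoℚ 2) * y
    ≡⟨ cong₂ (λ a b → ℕtoℚ 4 * P + ℕtoℚ 2 * (h - ℕtoℚ 2) * a + ℕtoℚ 2 * y * b + (h + r - ℕtoℚ 2) * y)
             sy≡2mx rs≡1 ⟨
  ℕtoℚ 4 * P + ℕtoℚ 2 * (h - ℕtoℚ 2) * (s * y) + ℕtoℚ 2 * y * (r * s) + (h + r - ℕtoℚ 2) * y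
    ≡⟨ solve (P ∷ h ∷ r ∷ s ∷ y ∷ []) ℚ-ring ⟩
  ℕtoℚ 4 * P + (h + r - ℕtoℚ 2) * (ℕtoℚ 2 * s + 1ℚ) * y ∎

oddHarmonic-recurrence-identity : ∀ o r s m x y →
  r * (ℕtoℚ 2 * s + 1ℚ) ≡ 1ℚ → s * y ≡ ℕtoℚ 2 * (m * x) →
  ℕtoℚ 4 * ((o - 1ℚ) * m * x) + y * o ≡ (o + r - 1ℚ) * (ℕtoℚ 2 * s + 1ℚ) * y
oddHarmonic-recurrence-identity o r s m x y r[2s+1]≡1 sy≡2mx = begin
  ℕtoℚ 4 * ((o - 1ℚ) * m * x) + y * o
    ≡⟨ solve (o ∷ m ∷ x ∷ y ∷ []) ℚ-ring ⟩
  ℕtoℚ 2 * (o - 1ℚ) * (ℕtoℚ 2 * (m * x)) + (o - 1ℚ) * y + 1ℚ * y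
    ≡⟨ cong₂ (λ a b → ℕtoℚ 2 * (o - 1ℚ) * a + (o - 1ℚ) * y + b * y) sy≡2mx r[2s+1]≡1 ⟨
  ℕtoℚ 2 * (o - 1ℚ) * (s * y) + (o - 1ℚ) * y + r * (ℕtoℚ 2 * s + 1ℚ) * y
    ≡⟨ solve (o ∷ r ∷ s ∷ y ∷ []) ℚ-ring ⟩
  (o + r - 1ℚ) * (ℕtoℚ 2 * s + 1ℚ) * y ∎

harmonicForm : ℕ → ℚ
harmonicForm n = ℕtoℚ (2 ^ (2 ℕ.* n ℕ.+ 1)) + (H n - ℕtoℚ 2) * ℕtoℚ (2 ℕ.* n ℕ.+ 1) * centralBinomial n

harmonicForm-suc : ∀ n →
  harmonicForm (suc n) ≡ ℕtoℚ 4 * harmonicForm n + centralBinomial (suc n) * H (suc n)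
harmonicForm-suc n = begin
  harmonicForm (suc n)
    ≡⟨ cong₂ (λ p t → p + (H (suc n) - ℕtoℚ 2) * t * centralBinomial (suc n)) 2^[2n+3] (ℕtoℚ-2m+1 (suc n)) ⟩
  ℕtoℚ 4 * P + (H n + recip (suc n) - ℕtoℚ 2) * (ℕtoℚ 2 * ℕtoℚ (suc n) + 1ℚ) * centralBinomial (suc n)
    ≡⟨ harmonic-recurrence-identity P (H n) (recip (suc n)) (ℕtoℚ (suc n)) (ℕtoℚ (2 ℕ.* n ℕ.+ 1))
         (centralBinomial n) (centralBinomial (suc n)) (recip-inverseˡ n) (centralBinomial-suc n) ⟨
  ℕtoℚ 4 * harmonicForm n + centralBinomial (suc n) * H (suc n) ∎
  where
  P : ℚ
  P = ℕtoℚ (2 ^ (2 ℕ.* n ℕ.+ 1))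
  2^[2n+3] : ℕtoℚ (2 ^ (2 ℕ.* suc n ℕ.+ 1)) ≡ ℕtoℚ 4 * P
  2^[2n+3] = trans (cong (λ e → ℕtoℚ (2 ^ (e ℕ.+ 1))) (ℕ.*-suc 2 n)) (ℕtoℚ-2^[2+m] (2 ℕ.* n ℕ.+ 1))

oddHarmonicForm : ℕ → ℚ
oddHarmonicForm n = (O (suc n) - ℕtoℚ 1) * ℕtoℚ (2 ℕ.* n ℕ.+ 1) * centralBinomial n

oddHarmonicForm-suc : ∀ n →
  oddHarmonicForm (suc n) ≡ ℕtoℚ 4 * oddHarmonicForm n + centralBinomial (suc n) * O (suc n)
oddHarmonicForm-suc n = begin
  oddHarmonicForm (suc n)
    ≡⟨ cong (λ t → (O (suc (suc n)) - 1ℚ) * t * centralBinomial (suc n)) (ℕtoℚ-2m+1 (suc n)) ⟩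
  (O (suc n) + oddRecip (suc (suc n)) - 1ℚ) * (ℕtoℚ 2 * ℕtoℚ (suc n) + 1ℚ) * centralBinomial (suc n)
    ≡⟨ oddHarmonic-recurrence-identity (O (suc n)) (oddRecip (suc (suc n))) (ℕtoℚ (suc n))
         (ℕtoℚ (2 ℕ.* n ℕ.+ 1)) (centralBinomial n) (centralBinomial (suc n)) inverse (centralBinomial-suc n) ⟨
  ℕtoℚ 4 * oddHarmonicForm n + centralBinomial (suc n) * O (suc n) ∎
  where
  inverse : oddRecip (suc (suc n)) * (ℕtoℚ 2 * ℕtoℚ (suc n) + 1ℚ) ≡ 1ℚ
  inverse = trans (cong (oddRecip (suc (suc n)) *_) (sym (ℕtoℚ-2m+1 (suc n)))) (oddRecip-inverseˡ (suc n))

triangleSum-harmonic : ∀ n → triangleSum fourPow recip centralBinomial n ≡ harmonicForm n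
triangleSum-harmonic =
  recurrence-unique (λ n t → ℕtoℚ 4 * t + centralBinomial (suc n) * H (suc n))
    refl (triangleSum-suc {q = ℕtoℚ 4} {fourPow} {recip} {centralBinomial} refl fourPow-suc)
    harmonicForm-suc

triangleSum-oddHarmonic : ∀ n → triangleSum fourPow oddRecip centralBinomial n ≡ oddHarmonicForm n
triangleSum-oddHarmonic =
  recurrence-unique (λ n t → ℕtoℚ 4 * t + centralBinomial (suc n) * O (suc n))
    refl (triangleSum-suc {q = ℕtoℚ 4} {fourPow} {oddRecip} {centralBinomial} refl fourPow-suc)
    oddHarmonicForm-suc

proposition19 : (n : ℕ) →
    (sum1to n (λ k → sumRange k (λ j →
        ℕtoℚ (2 ^ (2 ℕ.* j)) * recip (k ∸ j) * ℕtoℚ ((2 ℕ.* (n ∸ j)) C (n ∸ j))))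
      ≡ ℕtoℚ (2 ^ (2 ℕ.* n ℕ.+ 1)) + (H n - ℕtoℚ 2) * ℕtoℚ (2 ℕ.* n ℕ.+ 1) * ℕtoℚ ((2 ℕ.* n) C n))
    ×
    (sum1to n (λ k → sumRange k (λ j →
        ℕtoℚ (2 ^ (2 ℕ.* j)) * recip (2 ℕ.* k ∸ 2 ℕ.* j ∸ 1) * ℕtoℚ ((2 ℕ.* (n ∸ j)) C (n ∸ j))))
      ≡ (O (ℕ.suc n) - ℕtoℚ 1) * ℕtoℚ (2 ℕ.* n ℕ.+ 1) * ℕtoℚ ((2 ℕ.* n) C n))
proposition19 n = triangleSum-harmonic n , trans (regroup-denominators n) (triangleSum-oddHarmonic n)
  where
  regroup-denominators : ∀ m →
    sum1to m (λ k → sumRange k (λ j → fourPow j * recip (2 ℕ.* k ∸ 2 ℕ.* j ∸ 1) * centralBinomial (m ∸ j)))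
      ≡ triangleSum fourPow oddRecip centralBinomial m
  regroup-denominators m = sumRange-cong m (λ k → sumRange-cong (suc k) (λ j →
    cong (λ e → fourPow j * recip (e ∸ 1) * centralBinomial (m ∸ j)) (sym (ℕ.*-distribˡ-∸ 2 (suc k) j))))
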